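{- The equal length relation $R_{\mathsf{len}}=\{(w_1,w_2)\in(\Sigma^*)^2 : |w_1|=|w_2|\}$ is selectable in $\mathsf{DynCQ}$; that is, the relation $\bar R_{\mathsf{len}}=\{(u_1,u_2,v_1,v_2)\in D^4 : |w[u_1,u_2]|=|w[v_1,v_2]|\}$ can be maintained in $\mathsf{DynCQ}$.
   Context: Dynamic setting. Fix a finite alphabet $\Sigma$. A word-structure has domain $D=\{1,\dots,n+1\}$ ($n\ge0$), the linear order $<$, a constant $\$=n+1$, and for each $\zeta\in\Sigma$ a unary relation $R_\zeta\subseteq\{1,\dots,n\}$, each position in at most one $R_\zeta$. Write $w(i)=\zeta$ if $R_\zeta(i)$ and $w(i)=\varepsilon$ otherwise; the word is $w=w(1)\cdots w(n)$ and $w[i,j]=w(i)\cdots w(j)$. Updates $\mathsf{ins}_\zeta(i)$ (set $w(i)=\zeta$) and $\mathsf{reset}(i)$ (set $w(i)=\varepsilon$), $i\le n$, are allowed only if they change the word-structure; initially all positions are $\varepsilon$. A dynamic program has finitely many auxiliary relations over $D$, initialized by first-order formulas, and for each auxiliary relation $R$ (arity $k$) and each abstract update $\mathsf{op}$ an update formula $\varphi^R_{\mathsf{op}}(y;x_1,\dots,x_k)$; after applying $\mathsf{op}$ at $i$, the new $R$ is the set of $\vec j$ with $\varphi^R_{\mathsf{op}}(i;\vec j)$ true in the updated word-structure with the old auxiliary relations. A program maintains a relation if a designated auxiliary relation equals it after every sequence of updates. $\mathsf{DynCQ}$: all update formulas are conjunctive queries (built from atoms by conjunction and existential quantification). -}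

module Defs where

open import Data.Nat using (ℕ; zero; suc; _+_; _≤ᵇ_; _≡ᵇ_)
open import Data.Bool using (Bool; true; false; _∧_; _∨_; not; if_then_else_)
open import Data.Fin using (Fin; zero; suc; toℕ; fromℕ; inject₁; _≟_)
open import Data.Maybe using (Maybe; just; nothing)
open import Data.Vec using (Vec; []; _∷_; lookup; map; replicate; _[_]≔_)
open import Data.Product using (Σ; _×_; _,_; proj₁; proj₂)
open import Relation.Nullary using (¬_)
open import Relation.Nullary.Decidable using (⌊_⌋)
open import Relation.Binary.PropositionalEquality using (_≡_; subst; sym)

-- A word of length n is a vector of
-- n entries, each either a letter (just ζ) or ε (nothing).
-- The domain of the word-structure D = {1,…,n+1} is represented by
-- Fin (suc n) = {0,…,n} (shifted by one; the order is preserved);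
-- the constant $ is the last element fromℕ n.

Word : ℕ → ℕ → Set
Word k n = Vec (Maybe (Fin k)) n

-- w(p) for a domain element p; the position $ always carries ε.
wordAt : ∀ {k n} → Word k n → Fin (suc n) → Maybe (Fin k)
wordAt []      _       = nothing
wordAt (x ∷ w) zero    = x
wordAt (x ∷ w) (suc p) = wordAt w p

isLetter : ∀ {k} → Maybe (Fin k) → Bool
isLetter (just _) = true
isLetter nothing  = false

sameLetter : ∀ {k} → Maybe (Fin k) → Fin k → Bool
sameLetter (just c) ζ = ⌊ c ≟ ζ ⌋
sameLetter nothing  ζ = false

anyFin : ∀ {m} → (Fin m → Bool) → Bool
anyFin {zero}  f = false
anyFin {suc m} f = f zero ∨ anyFin (λ i → f (suc i))

countFin : ∀ {m} → (Fin m → Bool) → ℕ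
countFin {zero}  f = 0
countFin {suc m} f = (if f zero then 1 else 0) + countFin (λ i → f (suc i))

-- Formulas with m
-- free variables (Fin m).  ¬, ∧, ∃ is a complete set of connectives.

data Term (m : ℕ) : Set where
  var    : Fin m → Term m
  dollar : Term m

data Formula (k a : ℕ) (ar : Fin a → ℕ) : ℕ → Set where
  lt     : ∀ {m} → Term m → Term m → Formula k a ar m
  eq     : ∀ {m} → Term m → Term m → Formula k a ar m
  letter : ∀ {m} → Fin k → Term m → Formula k a ar m
  rel    : ∀ {m} → (r : Fin a) → Vec (Term m) (ar r) → Formula k a ar m
  neg    : ∀ {m} → Formula k a ar m → Formula k a ar m
  and    : ∀ {m} → Formula k a ar m → Formula k a ar m → Formula k a ar m
  ex     : ∀ {m} → Formula k a ar (suc m) → Formula k a ar m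

data IsCQ {k a : ℕ} {ar : Fin a → ℕ} : ∀ {m} → Formula k a ar m → Set where
  lt     : ∀ {m} (s t : Term m) → IsCQ (lt s t)
  eq     : ∀ {m} (s t : Term m) → IsCQ (eq s t)
  letter : ∀ {m} ζ (t : Term m) → IsCQ (letter ζ t)
  rel    : ∀ {m} r (ts : Vec (Term m) (ar r)) → IsCQ (rel r ts)
  and    : ∀ {m} {φ ψ : Formula k a ar m} → IsCQ φ → IsCQ ψ → IsCQ (and φ ψ)
  ex     : ∀ {m} {φ : Formula k a ar (suc m)} → IsCQ φ → IsCQ (ex φ)

Interp : (n a : ℕ) → (Fin a → ℕ) → Set
Interp n a ar = (r : Fin a) → Vec (Fin (suc n)) (ar r) → Bool

extend : ∀ {n m} → Fin (suc n) → (Fin m → Fin (suc n)) → Fin (suc m) → Fin (suc n)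
extend d ρ zero    = d
extend d ρ (suc i) = ρ i

evalT : ∀ {n m} → (Fin m → Fin (suc n)) → Term m → Fin (suc n)
evalT ρ (var i)        = ρ i
evalT {n} ρ dollar     = fromℕ n

eval : ∀ {k n a} {ar : Fin a → ℕ} → Word k n → Interp n a ar →
       ∀ {m} → Formula k a ar m → (Fin m → Fin (suc n)) → Bool
eval w I (lt s t) ρ     = toℕ (evalT ρ s) Data.Nat.<ᵇ toℕ (evalT ρ t)
eval w I (eq s t) ρ     = ⌊ evalT ρ s ≟ evalT ρ t ⌋
eval w I (letter ζ t) ρ = sameLetter (wordAt w (evalT ρ t)) ζ
eval w I (rel r ts) ρ   = I r (map (evalT ρ) ts)
eval w I (neg φ) ρ      = not (eval w I φ ρ)
eval w I (and φ ψ) ρ    = eval w I φ ρ ∧ eval w I ψ ρ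
eval w I (ex φ) ρ       = anyFin (λ d → eval w I φ (extend d ρ))

data Op (k : ℕ) : Set where
  ins   : Fin k → Op k
  reset : Op k

newEntry : ∀ {k} → Op k → Maybe (Fin k)
newEntry (ins ζ) = just ζ
newEntry reset   = nothing

Allowed : ∀ {k} → Op k → Maybe (Fin k) → Set
Allowed (ins ζ) c = ¬ (c ≡ just ζ)
Allowed reset   c = ¬ (c ≡ nothing)

noAux : Fin 0 → ℕ
noAux ()

noInterp : ∀ {n} → Interp n 0 noAux
noInterp ()

record DynProg (k : ℕ) : Set where
  field
    a    : ℕ
    ar   : Fin a → ℕ
    init : (r : Fin a) → Formula k 0 noAux (ar r)
    -- update formulas φ^R_op(y; x₁,…,x_ar) : variable zero is y
    upd  : Op k → (r : Fin a) → Formula k a ar (suc (ar r))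

open DynProg public

State : ∀ {k} → DynProg k → ℕ → Set
State {k} P n = Word k n × Interp n (a P) (ar P)

initState : ∀ {k} (P : DynProg k) (n : ℕ) → State P n
initState P n =
  replicate n nothing ,
  λ r js → eval (replicate n nothing) noInterp (init P r) (lookup js)

step : ∀ {k n} (P : DynProg k) → Op k → Fin n → State P n → State P n
step P op i (w , I) =
  let w' = w [ i ]≔ newEntry op in
  w' , λ r js → eval w' I (upd P op r) (extend (inject₁ i) (lookup js))

data Reach {k} (P : DynProg k) (n : ℕ) : State P n → Set where
  start : Reach P n (initState P n)
  next  : ∀ {s} (op : Op k) (i : Fin n) → Reach P n s →
          Allowed op (lookup (proj₁ s) i) → Reach P n (step P op i s)

Maintains : ∀ {k} → DynProg k → (q : ℕ) →
            (∀ {n} → Word k n → Vec (Fin (suc n)) q → Bool) → Set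
Maintains P q Q =
  Σ (Fin (a P)) λ r → Σ (ar P r ≡ q) λ e →
    ∀ n (s : State P n) → Reach P n s → ∀ (us : Vec (Fin (suc n)) q) →
      proj₂ s r (subst (Vec _) (sym e) us) ≡ Q (proj₁ s) us

IsDynCQ : ∀ {k} → DynProg k → Set
IsDynCQ P = ∀ op r → IsCQ (upd P op r)

MaintainableInDynCQ : ∀ {k} (q : ℕ) → (∀ {n} → Word k n → Vec (Fin (suc n)) q → Bool) → Set
MaintainableInDynCQ {k} q Q = Σ (DynProg k) λ P → IsDynCQ P × Maintains P q Q

subLen : ∀ {k n} → Word k n → Fin (suc n) → Fin (suc n) → ℕ
subLen w u₁ u₂ =
  countFin (λ p → (toℕ u₁ ≤ᵇ toℕ p) ∧ (toℕ p ≤ᵇ toℕ u₂) ∧ isLetter (wordAt w p))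

RlenBar : ∀ {k n} → Word k n → Vec (Fin (suc n)) 4 → Bool
RlenBar w (u₁ ∷ u₂ ∷ v₁ ∷ v₂ ∷ []) = subLen w u₁ u₂ ≡ᵇ subLen w v₁ v₂

-- Besides R̄_len the program maintains C(u₁,u₂,m) ⇔ m = |w[u₁,u₂]|, a length
-- stored as a position, and the flags F(x,b) ⇔ b = (x if w(x) is a letter, $
-- otherwise), a negation-free way of recording which positions carry letters.
-- Conjunctive queries can neither negate nor branch, so all case distinctions are
-- moved into two static relations, defined by first-order initialisation formulas
-- and copied by every update: Q(y,f,x,b′,b) describes the flags after the flag of
-- y became f, and S(b,f,y,u₁,u₂,M,m) says that a length m becomes M (by +1, -1 or
-- 0) when the flag of y changes from b to f.  After an update at y, whose new flag
-- f is the term y or $ depending only on the kind of update,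
--   C′(u₁,u₂,M) = ∃b ∃m. F(y,b) ∧ C(u₁,u₂,m) ∧ S(b,f,y,u₁,u₂,M,m),
--   R̄′(u₁,u₂,v₁,v₂) = ∃m. C′(u₁,u₂,m) ∧ C′(v₁,v₂,m),
-- and since F and C pin b and m down uniquely these are correct.  Nothing uses that
-- an update changes the word.
module Submission where

open import Data.Bool using (Bool; true; false; _∧_; _∨_; not; if_then_else_)
open import Data.Bool.Properties using (if-float; ∧-zeroʳ; ∧-conicalʳ; ∨-zeroʳ)
open import Data.Fin using (Fin; zero; suc; toℕ; fromℕ; fromℕ<; inject₁; _≟_; #_)
open import Data.Fin.Properties using (suc-injective; toℕ-injective; toℕ-fromℕ<; toℕ<n; fromℕ≢inject₁)
open import Data.Maybe using (Maybe; nothing)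
open import Data.Nat using (ℕ; zero; suc; _+_; _<_; _≤_; _≤ᵇ_; _<ᵇ_; _≡ᵇ_; z≤n; s≤s)
import Data.Nat.Properties as ℕ
open import Algebra.Properties.CommutativeSemigroup ℕ.+-commutativeSemigroup using (x∙yz≈y∙xz)
open import Data.Product using (_,_; proj₁; proj₂)
open import Data.Vec using ([]; _∷_; lookup; replicate; tabulate; _[_]≔_)
open import Function using (_∘_)
open import Function.Bundles using (mk⇔)
open import Relation.Binary using (tri<; tri≈; tri>)
open import Relation.Binary.PropositionalEquality
  using (_≡_; _≢_; refl; sym; trans; cong; cong₂; subst; module ≡-Reasoning)
open import Relation.Nullary using (Dec; yes; no; ¬_; ¬?; does; contradiction)
open import Relation.Nullary.Decidable using (⌊_⌋; isYes≗does; dec-true; dec-false; does-⇔)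

open import Defs

open ≡-Reasoning

bit : Bool → ℕ
bit b = if b then 1 else 0

bit-≤1 : ∀ b → bit b ≤ 1
bit-≤1 true  = s≤s z≤n
bit-≤1 false = z≤n

bit-mono : ∀ {x y} → (x ≡ true → y ≡ true) → bit x ≤ bit y
bit-mono {false} _   = z≤n
bit-mono {true}  x⇒y with refl ← x⇒y refl = s≤s z≤n

does-sound : ∀ {A : Set} (a? : Dec A) → does a? ≡ true → A
does-sound (yes a) _ = a

⌊⌋-sound : ∀ {A : Set} (a? : Dec A) → ⌊ a? ⌋ ≡ true → A
⌊⌋-sound (yes a) _ = a

⌊⌋-true : ∀ {A : Set} (a? : Dec A) → A → ⌊ a? ⌋ ≡ true
⌊⌋-true a? a = trans (isYes≗does a?) (dec-true a? a)

⌊≟⌋-toℕ : ∀ {m} (a b : Fin m) → ⌊ a ≟ b ⌋ ≡ (toℕ a ≡ᵇ toℕ b)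
⌊≟⌋-toℕ a b =
  trans (isYes≗does (a ≟ b)) (does-⇔ (mk⇔ (cong toℕ) toℕ-injective) (a ≟ b) (toℕ a ℕ.≟ toℕ b))

<ᵇ-true : ∀ {m n} → m < n → (m <ᵇ n) ≡ true
<ᵇ-true {m} {n} = dec-true (m ℕ.<? n)

<ᵇ-false : ∀ {m n} → ¬ m < n → (m <ᵇ n) ≡ false
<ᵇ-false {m} {n} = dec-false (m ℕ.<? n)

<ᵇ-sound : ∀ {m n} → (m <ᵇ n) ≡ true → m < n
<ᵇ-sound {m} {n} = does-sound (m ℕ.<? n)

≡ᵇ-true : ∀ {m n} → m ≡ n → (m ≡ᵇ n) ≡ true
≡ᵇ-true {m} {n} = dec-true (m ℕ.≟ n)

≡ᵇ-false : ∀ {m n} → m ≢ n → (m ≡ᵇ n) ≡ false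
≡ᵇ-false {m} {n} = dec-false (m ℕ.≟ n)

≡ᵇ-sound : ∀ {m n} → (m ≡ᵇ n) ≡ true → m ≡ n
≡ᵇ-sound {m} {n} = does-sound (m ℕ.≟ n)

≡ᵇ-sym : ∀ m n → (m ≡ᵇ n) ≡ (n ≡ᵇ m)
≡ᵇ-sym m n = does-⇔ (mk⇔ sym sym) (m ℕ.≟ n) (n ℕ.≟ m)

not-<ᵇ : ∀ m n → not (n <ᵇ m) ≡ (m ≤ᵇ n)
not-<ᵇ m n = does-⇔ (mk⇔ ℕ.≮⇒≥ ℕ.≤⇒≯) (¬? (n ℕ.<? m)) (m ℕ.≤? n)

+-cancelˡ-≡ᵇ : ∀ c m n → (c + m ≡ᵇ c + n) ≡ (m ≡ᵇ n)
+-cancelˡ-≡ᵇ zero    m n = refl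
+-cancelˡ-≡ᵇ (suc c) m n = +-cancelˡ-≡ᵇ c m n

if-as-and-not : ∀ c x y → not (not (c ∧ x) ∧ not (not c ∧ y)) ≡ (if c then x else y)
if-as-and-not true  true  y     = refl
if-as-and-not true  false y     = refl
if-as-and-not false x     true  = refl
if-as-and-not false x     false = refl

anyFin-cong : ∀ {m} {f g : Fin m → Bool} → (∀ i → f i ≡ g i) → anyFin f ≡ anyFin g
anyFin-cong {zero}  f≗g = refl
anyFin-cong {suc m} f≗g = cong₂ _∨_ (f≗g zero) (anyFin-cong (f≗g ∘ suc))

anyFin-true : ∀ {m} {f : Fin m → Bool} (c : Fin m) → f c ≡ true → anyFin f ≡ true
anyFin-true {f = f} zero    fc = cong (_∨ anyFin (f ∘ suc)) fc
anyFin-true {f = f} (suc c) fc = trans (cong (f zero ∨_) (anyFin-true c fc)) (∨-zeroʳ (f zero))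

anyFin-false : ∀ {m} {f : Fin m → Bool} → (∀ i → f i ≡ false) → anyFin f ≡ false
anyFin-false {zero}  f≗false = refl
anyFin-false {suc m} f≗false = cong₂ _∨_ (f≗false zero) (anyFin-false (f≗false ∘ suc))

anyFin-onePoint : ∀ {m} (E P : Fin m → Bool) {c : Fin m} →
                  E c ≡ true → (∀ x → E x ≡ true → x ≡ c) →
                  anyFin (λ x → E x ∧ P x) ≡ P c
anyFin-onePoint E P {c} Ec E⇒c with P c in Pc
... | true  = anyFin-true c (cong₂ _∧_ Ec Pc)
... | false = anyFin-false E∧P≡false
  where
  E∧P≡false : ∀ x → E x ∧ P x ≡ false
  E∧P≡false x with E x in Ex
  ... | true  = trans (cong P (E⇒c x Ex)) Pc
  ... | false = refl

anyFin-≟-onePoint : ∀ {m} (c : Fin m) (P : Fin m → Bool) → anyFin (λ x → ⌊ x ≟ c ⌋ ∧ P x) ≡ P c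
anyFin-≟-onePoint c P =
  anyFin-onePoint (λ x → ⌊ x ≟ c ⌋) P (⌊⌋-true (c ≟ c) refl) (λ x → ⌊⌋-sound (x ≟ c))

anyFin-toℕ-onePoint : ∀ {m} L (P : ℕ → Bool) → L < m →
                      anyFin {m} (λ x → (toℕ x ≡ᵇ L) ∧ P (toℕ x)) ≡ P L
anyFin-toℕ-onePoint L P L<m =
  trans (anyFin-onePoint (λ x → toℕ x ≡ᵇ L) (P ∘ toℕ) (≡ᵇ-true (toℕ-fromℕ< L<m)) unique)
        (cong P (toℕ-fromℕ< L<m))
  where
  unique : ∀ x → (toℕ x ≡ᵇ L) ≡ true → x ≡ fromℕ< L<m
  unique x x≡L = toℕ-injective (trans (≡ᵇ-sound x≡L) (sym (toℕ-fromℕ< L<m)))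

countFin-cong : ∀ {m} {f g : Fin m → Bool} → (∀ i → f i ≡ g i) → countFin f ≡ countFin g
countFin-cong {zero}  f≗g = refl
countFin-cong {suc m} f≗g = cong₂ (λ b c → bit b + c) (f≗g zero) (countFin-cong (f≗g ∘ suc))

countFin-false : ∀ {m} {f : Fin m → Bool} → (∀ i → f i ≡ false) → countFin f ≡ 0
countFin-false {zero}  f≗false = refl
countFin-false {suc m} {f} f≗false
  rewrite f≗false zero = countFin-false (f≗false ∘ suc)

countFin-mono : ∀ {m} {f g : Fin m → Bool} → (∀ i → f i ≡ true → g i ≡ true) → countFin f ≤ countFin g
countFin-mono {zero}  f⇒g = z≤n
countFin-mono {suc m} f⇒g = ℕ.+-mono-≤ (bit-mono (f⇒g zero)) (countFin-mono (f⇒g ∘ suc))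

countFin-agree-except : ∀ {m} (f g : Fin m → Bool) (j : Fin m) → (∀ i → i ≢ j → f i ≡ g i) →
                        bit (g j) + countFin f ≡ bit (f j) + countFin g
countFin-agree-except {suc m} f g zero f≈g = begin
    bit (g zero) + (bit (f zero) + countFin (f ∘ suc))
  ≡⟨ cong (λ c → bit (g zero) + (bit (f zero) + c)) (countFin-cong (λ i → f≈g (suc i) λ ())) ⟩
    bit (g zero) + (bit (f zero) + countFin (g ∘ suc))
  ≡⟨ x∙yz≈y∙xz (bit (g zero)) (bit (f zero)) _ ⟩
    bit (f zero) + (bit (g zero) + countFin (g ∘ suc))
  ∎
countFin-agree-except {suc m} f g (suc j) f≈g = begin
    bit (g (suc j)) + (bit (f zero) + countFin (f ∘ suc))
  ≡⟨ x∙yz≈y∙xz (bit (g (suc j))) (bit (f zero)) _ ⟩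
    bit (f zero) + (bit (g (suc j)) + countFin (f ∘ suc))
  ≡⟨ cong₂ _+_ (cong bit (f≈g zero λ ()))
               (countFin-agree-except (f ∘ suc) (g ∘ suc) j (λ i i≢j → f≈g (suc i) (i≢j ∘ suc-injective))) ⟩
    bit (g zero) + (bit (f (suc j)) + countFin (g ∘ suc))
  ≡⟨ x∙yz≈y∙xz (bit (g zero)) (bit (f (suc j))) _ ⟩
    bit (f (suc j)) + (bit (g zero) + countFin (g ∘ suc))
  ∎

inside : ∀ {n} (u₁ u₂ p : Fin (suc n)) → Bool → Bool
inside u₁ u₂ p ℓ = (toℕ u₁ ≤ᵇ toℕ p) ∧ (toℕ p ≤ᵇ toℕ u₂) ∧ ℓ

flagFor : ∀ {n} → Bool → Fin (suc n) → Fin (suc n)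
flagFor {n} ℓ p = if ℓ then p else fromℕ n

marksLetter : ∀ {n} → Fin (suc n) → Bool
marksLetter {n} b = not ⌊ b ≟ fromℕ n ⌋

marksLetter-flagFor : ∀ {n} ℓ {p : Fin (suc n)} → p ≢ fromℕ n → marksLetter (flagFor ℓ p) ≡ ℓ
marksLetter-flagFor {n} true  {p} p≢$ with p ≟ fromℕ n
... | yes p≡$ = contradiction p≡$ p≢$
... | no  _   = refl
marksLetter-flagFor {n} false p≢$ = cong not (⌊⌋-true (fromℕ n ≟ fromℕ n) refl)

module _ {k : ℕ} where

  wordAt∘update : ∀ {n} (w : Word k n) (i : Fin n) e → wordAt (w [ i ]≔ e) (inject₁ i) ≡ e
  wordAt∘update (c ∷ w) zero    e = refl
  wordAt∘update (c ∷ w) (suc i) e = wordAt∘update w i e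

  wordAt∘update′ : ∀ {n} (w : Word k n) (i : Fin n) e {p} → p ≢ inject₁ i →
                   wordAt (w [ i ]≔ e) p ≡ wordAt w p
  wordAt∘update′ (c ∷ w) zero    e {zero}  p≢i = contradiction refl p≢i
  wordAt∘update′ (c ∷ w) zero    e {suc p} p≢i = refl
  wordAt∘update′ (c ∷ w) (suc i) e {zero}  p≢i = refl
  wordAt∘update′ (c ∷ w) (suc i) e {suc p} p≢i = wordAt∘update′ w i e (p≢i ∘ cong suc)

  wordAt-replicate : ∀ {n} (p : Fin (suc n)) → wordAt {k} (replicate n nothing) p ≡ nothing
  wordAt-replicate {zero}  p       = refl
  wordAt-replicate {suc n} zero    = refl
  wordAt-replicate {suc n} (suc p) = wordAt-replicate p

  letterCount-≤ : ∀ {n} (w : Word k n) → countFin {suc n} (λ p → isLetter (wordAt w p)) ≤ n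
  letterCount-≤ []      = z≤n
  letterCount-≤ (c ∷ w) = ℕ.+-mono-≤ (bit-≤1 (isLetter c)) (letterCount-≤ w)

  subLen-≤ : ∀ {n} (w : Word k n) (u₁ u₂ : Fin (suc n)) → subLen w u₁ u₂ ≤ n
  subLen-≤ w u₁ u₂ = ℕ.≤-trans (countFin-mono inside⇒letter) (letterCount-≤ w)
    where
    inside⇒letter : ∀ p → inside u₁ u₂ p (isLetter (wordAt w p)) ≡ true → isLetter (wordAt w p) ≡ true
    inside⇒letter p = ∧-conicalʳ (toℕ p ≤ᵇ toℕ u₂) _ ∘ ∧-conicalʳ (toℕ u₁ ≤ᵇ toℕ p) _

  subLen-replicate : ∀ {n} (u₁ u₂ : Fin (suc n)) → subLen {k} (replicate n nothing) u₁ u₂ ≡ 0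
  subLen-replicate {n} u₁ u₂ = countFin-false λ p →
    trans (cong (inside u₁ u₂ p ∘ isLetter) (wordAt-replicate {n = n} p))
          (trans (cong ((toℕ u₁ ≤ᵇ toℕ p) ∧_) (∧-zeroʳ (toℕ p ≤ᵇ toℕ u₂)))
                 (∧-zeroʳ (toℕ u₁ ≤ᵇ toℕ p)))

  subLen-update : ∀ {n} (w : Word k n) (i : Fin n) e (u₁ u₂ : Fin (suc n)) →
    bit (inside u₁ u₂ (inject₁ i) (isLetter e)) + subLen w u₁ u₂
      ≡ bit (inside u₁ u₂ (inject₁ i) (isLetter (wordAt w (inject₁ i)))) + subLen (w [ i ]≔ e) u₁ u₂
  subLen-update {n} w i e u₁ u₂ = begin
      bit (counted′ e) + subLen w u₁ u₂
    ≡⟨ cong (λ c → bit (counted′ c) + subLen w u₁ u₂) (sym (wordAt∘update w i e)) ⟩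
      bit (counted (w [ i ]≔ e) (inject₁ i)) + subLen w u₁ u₂
    ≡⟨ countFin-agree-except (counted w) (counted (w [ i ]≔ e)) (inject₁ i) agree ⟩
      bit (counted w (inject₁ i)) + subLen (w [ i ]≔ e) u₁ u₂
    ∎
    where
    counted′ : Maybe (Fin k) → Bool
    counted′ c = inside u₁ u₂ (inject₁ i) (isLetter c)
    counted : Word k n → Fin (suc n) → Bool
    counted v p = inside u₁ u₂ p (isLetter (wordAt v p))
    agree : ∀ p → p ≢ inject₁ i → counted w p ≡ counted (w [ i ]≔ e) p
    agree p p≢i = cong (inside u₁ u₂ p ∘ isLetter) (sym (wordAt∘update′ w i e p≢i))

  flag : ∀ {n} → Word k n → Fin (suc n) → Fin (suc n)
  flag w p = flagFor (isLetter (wordAt w p)) p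

  flag-update : ∀ {n} (w : Word k n) (i : Fin n) e (x : Fin (suc n)) →
    flag (w [ i ]≔ e) x ≡ (if ⌊ inject₁ i ≟ x ⌋ then flagFor (isLetter e) (inject₁ i) else flag w x)
  flag-update w i e x with inject₁ i ≟ x
  ... | yes refl = cong (λ c → flagFor (isLetter c) (inject₁ i)) (wordAt∘update w i e)
  ... | no  i≢x  = cong (λ c → flagFor (isLetter c) x) (wordAt∘update′ w i e (i≢x ∘ sym))

eval-cong : ∀ {k n a} {ar : Fin a → ℕ} {w : Word k n} {I J : Interp n a ar} →
            (∀ r js → I r js ≡ J r js) → ∀ {m} (φ : Formula k a ar m) ρ → eval w I φ ρ ≡ eval w J φ ρ
eval-cong I≗J (lt s t)     ρ = refl
eval-cong I≗J (eq s t)     ρ = refl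
eval-cong I≗J (letter ζ t) ρ = refl
eval-cong I≗J (rel r ts)   ρ = I≗J r _
eval-cong I≗J (neg φ)      ρ = cong not (eval-cong I≗J φ ρ)
eval-cong I≗J (and φ ψ)    ρ = cong₂ _∧_ (eval-cong I≗J φ ρ) (eval-cong I≗J ψ ρ)
eval-cong {w = w} I≗J (ex φ) ρ = anyFin-cong λ d → eval-cong {w = w} I≗J φ (extend d ρ)

noneBelow : ∀ {n} (p : Fin (suc n)) → not (anyFin {suc n} (λ z → toℕ z <ᵇ toℕ p)) ≡ (toℕ p ≡ᵇ 0)
noneBelow {n} zero = cong not (anyFin-false {suc n} {f = λ z → toℕ z <ᵇ 0} λ _ → refl)
noneBelow (suc p)  = refl

strictlyBetween : ℕ → ℕ → ℕ → Bool
strictlyBetween a b x = (a <ᵇ x) ∧ (x <ᵇ b)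

noneBetween : ∀ a x → strictlyBetween a (suc a) x ≡ false
noneBetween a x with a <ᵇ x in a<x
... | false = refl
... | true  = <ᵇ-false {x} {suc a} (ℕ.≤⇒≯ (<ᵇ-sound {a} {x} a<x))

succ-by-betweenness : ∀ {n} a b → b < suc n →
  (a <ᵇ b) ∧ not (anyFin {suc n} (strictlyBetween a b ∘ toℕ)) ≡ (suc a ≡ᵇ b)
succ-by-betweenness {n} a b b<1+n with ℕ.<-cmp (suc a) b
... | tri< 1+a<b _ _ =
  trans (cong₂ (λ x y → x ∧ not y) (<ᵇ-true {a} {b} (ℕ.<-trans (ℕ.n<1+n a) 1+a<b)) someBetween)
        (sym (≡ᵇ-false (ℕ.<⇒≢ 1+a<b)))
  where
  1+a<1+n = ℕ.<-trans 1+a<b b<1+n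
  someBetween : anyFin {suc n} (strictlyBetween a b ∘ toℕ) ≡ true
  someBetween = anyFin-true {f = strictlyBetween a b ∘ toℕ} (fromℕ< 1+a<1+n)
    (subst (λ x → strictlyBetween a b x ≡ true) (sym (toℕ-fromℕ< 1+a<1+n))
           (cong₂ _∧_ (<ᵇ-true (ℕ.n<1+n a)) (<ᵇ-true 1+a<b)))
... | tri≈ _ refl _ =
  trans (cong₂ (λ x y → x ∧ not y) (<ᵇ-true {a} {suc a} (ℕ.n<1+n a)) noneBetween′)
        (sym (≡ᵇ-true {suc a} refl))
  where
  noneBetween′ : anyFin {suc n} (strictlyBetween a (suc a) ∘ toℕ) ≡ false
  noneBetween′ = anyFin-false {suc n} {f = strictlyBetween a (suc a) ∘ toℕ} (noneBetween a ∘ toℕ)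
... | tri> _ _ b<1+a =
  trans (cong (_∧ not (anyFin {suc n} (strictlyBetween a b ∘ toℕ)))
              (<ᵇ-false {a} {b} (ℕ.≤⇒≯ (ℕ.m<1+n⇒m≤n b<1+a))))
        (sym (≡ᵇ-false (ℕ.<⇒≢ b<1+a ∘ sym)))

module _ {k a : ℕ} {ar : Fin a → ℕ} where

  ite : ∀ {m} → Formula k a ar m → Formula k a ar m → Formula k a ar m → Formula k a ar m
  ite c φ ψ = neg (and (neg (and c φ)) (neg (and (neg c) ψ)))

  leqF : ∀ {m} → Term m → Term m → Formula k a ar m
  leqF s t = neg (lt t s)

  succF : ∀ {m} → Fin m → Fin m → Formula k a ar m
  succF s t = and (lt (var s) (var t)) (neg (ex (and (lt (var (suc s)) (var zero)) (lt (var zero) (var (suc t))))))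

  insideF : ∀ {m} (u₁ u₂ p : Term m) → Formula k a ar m → Formula k a ar m
  insideF u₁ u₂ p φ = and (leqF u₁ p) (and (leqF p u₂) φ)

  marksLetterF : ∀ {m} → Fin m → Formula k a ar m
  marksLetterF b = neg (eq (var b) dollar)

  bitSumEqF : ∀ {m} → Formula k a ar m → Formula k a ar m → Fin m → Fin m → Formula k a ar m
  bitSumEqF c d s t = ite c (ite d (eq (var s) (var t)) (succF s t)) (ite d (succF t s) (eq (var s) (var t)))

module _ {k n a : ℕ} {ar : Fin a → ℕ} (w : Word k n) (I : Interp n a ar) where

  eval-ite : ∀ {m} (c φ ψ : Formula k a ar m) ρ →
    eval w I (ite c φ ψ) ρ ≡ (if eval w I c ρ then eval w I φ ρ else eval w I ψ ρ)
  eval-ite c φ ψ ρ = if-as-and-not (eval w I c ρ) (eval w I φ ρ) (eval w I ψ ρ)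

  eval-insideF : ∀ {m} (u₁ u₂ p : Term m) φ ρ →
    eval w I (insideF u₁ u₂ p φ) ρ ≡ inside (evalT ρ u₁) (evalT ρ u₂) (evalT ρ p) (eval w I φ ρ)
  eval-insideF u₁ u₂ p φ ρ =
    cong₂ _∧_ (not-<ᵇ (toℕ (evalT ρ u₁)) (toℕ (evalT ρ p)))
              (cong (_∧ eval w I φ ρ) (not-<ᵇ (toℕ (evalT ρ p)) (toℕ (evalT ρ u₂))))

  eval-succF : ∀ {m} (s t : Fin m) ρ → eval w I (succF s t) ρ ≡ (suc (toℕ (ρ s)) ≡ᵇ toℕ (ρ t))
  eval-succF s t ρ = succ-by-betweenness (toℕ (ρ s)) (toℕ (ρ t)) (toℕ<n (ρ t))

  eval-bitSumEqF : ∀ {m} (c d : Formula k a ar m) (s t : Fin m) ρ →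
    eval w I (bitSumEqF c d s t) ρ ≡ (bit (eval w I c ρ) + toℕ (ρ s) ≡ᵇ bit (eval w I d ρ) + toℕ (ρ t))
  eval-bitSumEqF c d s t ρ = begin
      eval w I (ite c (ite d E (succF s t)) (ite d (succF t s) E)) ρ
    ≡⟨ eval-ite c (ite d E (succF s t)) (ite d (succF t s) E) ρ ⟩
      (if C then eval w I (ite d E (succF s t)) ρ else eval w I (ite d (succF t s) E) ρ)
    ≡⟨ cong₂ (if C then_else_) (eval-ite d E (succF s t) ρ) (eval-ite d (succF t s) E ρ) ⟩
      (if C then (if D then eval w I E ρ else eval w I (succF s t) ρ)
            else (if D then eval w I (succF t s) ρ else eval w I E ρ))
    ≡⟨ cong₂ (if C then_else_) (cong₂ (if D then_else_) E≡ (eval-succF s t ρ))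
                               (cong₂ (if D then_else_) (eval-succF t s ρ) E≡) ⟩
      (if C then (if D then (x ≡ᵇ y) else (suc x ≡ᵇ y)) else (if D then (suc y ≡ᵇ x) else (x ≡ᵇ y)))
    ≡⟨ cases C D ⟩
      (bit C + x ≡ᵇ bit D + y)
    ∎
    where
    E = eq (var s) (var t)
    C = eval w I c ρ
    D = eval w I d ρ
    x = toℕ (ρ s)
    y = toℕ (ρ t)
    E≡ : eval w I E ρ ≡ (x ≡ᵇ y)
    E≡ = ⌊≟⌋-toℕ (ρ s) (ρ t)
    cases : ∀ C D → (if C then (if D then (x ≡ᵇ y) else (suc x ≡ᵇ y))
                           else (if D then (suc y ≡ᵇ x) else (x ≡ᵇ y))) ≡ (bit C + x ≡ᵇ bit D + y)
    cases true  true  = refl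
    cases true  false = refl
    cases false true  = ≡ᵇ-sym (suc y) x
    cases false false = refl

flagStep : ∀ {n} (y f x b′ b : Fin (suc n)) → Bool
flagStep y f x b′ b = ⌊ b ≟ (if ⌊ y ≟ x ⌋ then f else b′) ⌋

lengthStep : ∀ {n} (b f p u₁ u₂ M m : Fin (suc n)) → Bool
lengthStep b f p u₁ u₂ M m =
  bit (inside u₁ u₂ p (marksLetter b)) + toℕ M ≡ᵇ bit (inside u₁ u₂ p (marksLetter f)) + toℕ m

module _ {k a : ℕ} {ar : Fin a → ℕ} where

  flagStepF : Formula k a ar 5
  flagStepF = ite (eq (var (# 0)) (var (# 2))) (eq (var (# 4)) (var (# 1))) (eq (var (# 4)) (var (# 3)))

  lengthStepF : Formula k a ar 7
  lengthStepF = bitSumEqF (insideF u₁ u₂ p (marksLetterF (# 0))) (insideF u₁ u₂ p (marksLetterF (# 1))) (# 5) (# 6)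
    where
    u₁ = var (# 3)
    u₂ = var (# 4)
    p  = var (# 2)

module _ {k n a : ℕ} {ar : Fin a → ℕ} (w : Word k n) (I : Interp n a ar) where

  eval-flagStepF : ∀ ρ → eval w I flagStepF ρ ≡ flagStep (ρ (# 0)) (ρ (# 1)) (ρ (# 2)) (ρ (# 3)) (ρ (# 4))
  eval-flagStepF ρ =
    trans (eval-ite w I (eq (var (# 0)) (var (# 2))) (eq (var (# 4)) (var (# 1))) (eq (var (# 4)) (var (# 3))) ρ)
          (sym (if-float (λ c → ⌊ ρ (# 4) ≟ c ⌋) ⌊ ρ (# 0) ≟ ρ (# 2) ⌋))

  eval-lengthStepF : ∀ ρ →
    eval w I lengthStepF ρ ≡ lengthStep (ρ (# 0)) (ρ (# 1)) (ρ (# 2)) (ρ (# 3)) (ρ (# 4)) (ρ (# 5)) (ρ (# 6))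
  eval-lengthStepF ρ =
    trans (eval-bitSumEqF w I (insideF u₁ u₂ p (marksLetterF (# 0))) (insideF u₁ u₂ p (marksLetterF (# 1)))
                          (# 5) (# 6) ρ)
          (cong₂ (λ x y → bit x + toℕ (ρ (# 5)) ≡ᵇ bit y + toℕ (ρ (# 6)))
                 (eval-insideF w I u₁ u₂ p (marksLetterF (# 0)) ρ)
                 (eval-insideF w I u₁ u₂ p (marksLetterF (# 1)) ρ))
    where
    u₁ u₂ p : Term 7
    u₁ = var (# 3)
    u₂ = var (# 4)
    p  = var (# 2)

pattern rR = zero
pattern rC = suc zero
pattern rF = suc (suc zero)
pattern rQ = suc (suc (suc zero))
pattern rS = suc (suc (suc (suc zero)))

arity : Fin 5 → ℕ
arity rR = 4
arity rC = 3
arity rF = 2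
arity rQ = 5
arity rS = 7

newFlagT : ∀ {m} → Bool → Fin m → Term m
newFlagT ℓ y = if ℓ then var y else dollar

evalT-newFlagT : ∀ {n m} ℓ (ρ : Fin m → Fin (suc n)) y → evalT ρ (newFlagT ℓ y) ≡ flagFor ℓ (ρ y)
evalT-newFlagT true  ρ y = refl
evalT-newFlagT false ρ y = refl

module _ {k : ℕ} where

  lengthAfterF : Bool → ∀ {m} (y u₁ u₂ M : Fin m) → Formula k 5 arity m
  lengthAfterF ℓ y u₁ u₂ M =
    ex (and (rel rF (var (suc y) ∷ var zero ∷ []))
    (ex (and (rel rC (↑↑ u₁ ∷ ↑↑ u₂ ∷ var zero ∷ []))
             (rel rS (var (suc zero) ∷ newFlagT ℓ (suc (suc y)) ∷ ↑↑ y ∷ ↑↑ u₁ ∷ ↑↑ u₂ ∷ ↑↑ M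
                      ∷ var zero ∷ [])))))
    where
    ↑↑ : Fin _ → Term _
    ↑↑ i = var (suc (suc i))

  copyF : (r : Fin 5) → Formula k 5 arity (suc (arity r))
  copyF r = rel r (tabulate (var ∘ suc))

  initF : (r : Fin 5) → Formula k 0 noAux (arity r)
  initF rR = eq (var (# 0)) (var (# 0))
  initF rC = neg (ex (lt (var zero) (var (# 3))))
  initF rF = eq (var (# 1)) dollar
  initF rQ = flagStepF
  initF rS = lengthStepF

  -- ℓ says whether the update writes a letter; variable 0 is the updated position.
  updateF : Bool → (r : Fin 5) → Formula k 5 arity (suc (arity r))
  updateF ℓ rR = ex (and (lengthAfterF ℓ (# 1) (# 2) (# 3) (# 0)) (lengthAfterF ℓ (# 1) (# 4) (# 5) (# 0)))
  updateF ℓ rC = lengthAfterF ℓ (# 0) (# 1) (# 2) (# 3)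
  updateF ℓ rF = ex (and (rel rF (var (# 2) ∷ var (# 0) ∷ []))
                         (rel rQ (var (# 1) ∷ newFlagT ℓ (# 1) ∷ var (# 2) ∷ var (# 0) ∷ var (# 3) ∷ [])))
  updateF ℓ rQ = copyF rQ
  updateF ℓ rS = copyF rS

  lengthAfterF-isCQ : ∀ ℓ {m} (y u₁ u₂ M : Fin m) → IsCQ (lengthAfterF ℓ y u₁ u₂ M)
  lengthAfterF-isCQ ℓ y u₁ u₂ M = ex (and (rel _ _) (ex (and (rel _ _) (rel _ _))))

  updateF-isCQ : ∀ ℓ r → IsCQ (updateF ℓ r)
  updateF-isCQ ℓ rR =
    ex (and (lengthAfterF-isCQ ℓ (# 1) (# 2) (# 3) (# 0)) (lengthAfterF-isCQ ℓ (# 1) (# 4) (# 5) (# 0)))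
  updateF-isCQ ℓ rC = lengthAfterF-isCQ ℓ (# 0) (# 1) (# 2) (# 3)
  updateF-isCQ ℓ rF = ex (and (rel _ _) (rel _ _))
  updateF-isCQ ℓ rQ = rel _ _
  updateF-isCQ ℓ rS = rel _ _

  program : DynProg k
  program = record { a = 5 ; ar = arity ; init = initF ; upd = updateF ∘ isLetter ∘ newEntry }

module _ {k : ℕ} where

  intended : ∀ {n} → Word k n → Interp n 5 arity
  intended w rR us                                  = RlenBar w us
  intended w rC (u₁ ∷ u₂ ∷ m ∷ [])                  = toℕ m ≡ᵇ subLen w u₁ u₂
  intended w rF (x ∷ b ∷ [])                        = ⌊ b ≟ flag w x ⌋
  intended w rQ (y ∷ f ∷ x ∷ b′ ∷ b ∷ [])           = flagStep y f x b′ b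
  intended w rS (b ∷ f ∷ p ∷ u₁ ∷ u₂ ∷ M ∷ m ∷ [])  = lengthStep b f p u₁ u₂ M m

  init-correct : ∀ n (r : Fin 5) js →
    eval (replicate n nothing) noInterp (initF {k} r) (lookup js) ≡ intended (replicate n nothing) r js
  init-correct n rR (u₁ ∷ u₂ ∷ v₁ ∷ v₂ ∷ []) =
    trans (⌊⌋-true (u₁ ≟ u₁) refl)
          (sym (cong₂ _≡ᵇ_ (subLen-replicate {k} u₁ u₂) (subLen-replicate {k} v₁ v₂)))
  init-correct n rC (u₁ ∷ u₂ ∷ m ∷ []) =
    trans (noneBelow m) (cong (toℕ m ≡ᵇ_) (sym (subLen-replicate {k} u₁ u₂)))
  init-correct n rF (x ∷ b ∷ []) = cong (λ c → ⌊ b ≟ flagFor (isLetter c) x ⌋) (sym (wordAt-replicate {k} x))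
  init-correct n rQ js@(_ ∷ _ ∷ _ ∷ _ ∷ _ ∷ []) =
    eval-flagStepF {k = k} (replicate n nothing) noInterp (lookup js)
  init-correct n rS js@(_ ∷ _ ∷ _ ∷ _ ∷ _ ∷ _ ∷ _ ∷ []) =
    eval-lengthStepF {k = k} (replicate n nothing) noInterp (lookup js)

  lengthAfter : ∀ {n} → Word k n → Bool → (y u₁ u₂ M : Fin (suc n)) → Bool
  lengthAfter w ℓ y u₁ u₂ M =
    anyFin λ b → ⌊ b ≟ flag w y ⌋ ∧
      anyFin λ m → (toℕ m ≡ᵇ subLen w u₁ u₂) ∧ lengthStep b (flagFor ℓ y) y u₁ u₂ M m

  eval-lengthAfterF : ∀ {n} (w w′ : Word k n) ℓ {m} (ρ : Fin m → Fin (suc n)) (y u₁ u₂ M : Fin m) →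
    eval w′ (intended w) (lengthAfterF ℓ y u₁ u₂ M) ρ ≡ lengthAfter w ℓ (ρ y) (ρ u₁) (ρ u₂) (ρ M)
  eval-lengthAfterF w w′ true  ρ y u₁ u₂ M = refl
  eval-lengthAfterF w w′ false ρ y u₁ u₂ M = refl

  lengthAfter-correct : ∀ {n} (w : Word k n) (i : Fin n) e (u₁ u₂ M : Fin (suc n)) →
    lengthAfter w (isLetter e) (inject₁ i) u₁ u₂ M ≡ (toℕ M ≡ᵇ subLen (w [ i ]≔ e) u₁ u₂)
  lengthAfter-correct {n} w i e u₁ u₂ M = begin
      lengthAfter w ℓ j u₁ u₂ M
    ≡⟨ anyFin-≟-onePoint (flag w j) (λ b → anyFin λ m → (toℕ m ≡ᵇ L) ∧ lengthStep b f j u₁ u₂ M m) ⟩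
      anyFin (λ m → (toℕ m ≡ᵇ L) ∧ lengthStep (flag w j) f j u₁ u₂ M m)
    ≡⟨ anyFin-toℕ-onePoint L (balance (marksLetter (flag w j)) (marksLetter f)) (s≤s (subLen-≤ w u₁ u₂)) ⟩
      balance (marksLetter (flag w j)) (marksLetter f) L
    ≡⟨ cong₂ (λ x y → balance x y L) (marksLetter-flagFor ℓ₀ j≢$) (marksLetter-flagFor ℓ j≢$) ⟩
      balance ℓ₀ ℓ L
    ≡⟨ cong (bit (inside u₁ u₂ j ℓ₀) + toℕ M ≡ᵇ_) (subLen-update w i e u₁ u₂) ⟩
      balance ℓ₀ ℓ₀ (subLen (w [ i ]≔ e) u₁ u₂)
    ≡⟨ +-cancelˡ-≡ᵇ (bit (inside u₁ u₂ j ℓ₀)) (toℕ M) _ ⟩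
      toℕ M ≡ᵇ subLen (w [ i ]≔ e) u₁ u₂
    ∎
    where
    j = inject₁ i
    ℓ = isLetter e
    ℓ₀ = isLetter (wordAt w j)
    f = flagFor ℓ j
    L = subLen w u₁ u₂
    balance : Bool → Bool → ℕ → Bool
    balance x y m = bit (inside u₁ u₂ j x) + toℕ M ≡ᵇ bit (inside u₁ u₂ j y) + m
    j≢$ : j ≢ fromℕ n
    j≢$ = fromℕ≢inject₁ ∘ sym

  lengthAfterF-correct : ∀ {n} (w : Word k n) (i : Fin n) e {m} (ρ : Fin m → Fin (suc n)) (y u₁ u₂ M : Fin m) →
    ρ y ≡ inject₁ i →
    eval (w [ i ]≔ e) (intended w) (lengthAfterF (isLetter e) y u₁ u₂ M) ρ
      ≡ (toℕ (ρ M) ≡ᵇ subLen (w [ i ]≔ e) (ρ u₁) (ρ u₂))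
  lengthAfterF-correct w i e ρ y u₁ u₂ M ρy≡i =
    trans (eval-lengthAfterF w (w [ i ]≔ e) (isLetter e) ρ y u₁ u₂ M)
          (trans (cong (λ p → lengthAfter w (isLetter e) p (ρ u₁) (ρ u₂) (ρ M)) ρy≡i)
                 (lengthAfter-correct w i e (ρ u₁) (ρ u₂) (ρ M)))

  update-correct : ∀ {n} (w : Word k n) (i : Fin n) e (r : Fin 5) js →
    eval (w [ i ]≔ e) (intended w) (updateF (isLetter e) r) (extend (inject₁ i) (lookup js))
      ≡ intended (w [ i ]≔ e) r js
  update-correct w i e rR us@(u₁ ∷ u₂ ∷ v₁ ∷ v₂ ∷ []) =
    trans (anyFin-cong λ m → cong₂ _∧_ (lengthAfterF-correct w i e (ρ m) (# 1) (# 2) (# 3) (# 0) refl)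
                                        (lengthAfterF-correct w i e (ρ m) (# 1) (# 4) (# 5) (# 0) refl))
          (anyFin-toℕ-onePoint _ (_≡ᵇ subLen (w [ i ]≔ e) v₁ v₂) (s≤s (subLen-≤ (w [ i ]≔ e) u₁ u₂)))
    where
    ρ : Fin _ → Fin 6 → Fin _
    ρ m = extend m (extend (inject₁ i) (lookup us))
  update-correct w i e rC us@(_ ∷ _ ∷ _ ∷ []) =
    lengthAfterF-correct w i e (extend (inject₁ i) (lookup us)) (# 0) (# 1) (# 2) (# 3) refl
  update-correct w i e rF (x ∷ b ∷ []) = begin
      anyFin (λ b′ → ⌊ b′ ≟ flag w x ⌋ ∧ flagStep j (evalT (extend b′ ρ) (newFlagT ℓ (# 1))) x b′ b)
    ≡⟨ anyFin-cong (λ b′ → cong (λ f → ⌊ b′ ≟ flag w x ⌋ ∧ flagStep j f x b′ b)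
                                (evalT-newFlagT ℓ (extend b′ ρ) (# 1))) ⟩
      anyFin (λ b′ → ⌊ b′ ≟ flag w x ⌋ ∧ flagStep j (flagFor ℓ j) x b′ b)
    ≡⟨ anyFin-≟-onePoint (flag w x) (λ b′ → flagStep j (flagFor ℓ j) x b′ b) ⟩
      ⌊ b ≟ (if ⌊ j ≟ x ⌋ then flagFor ℓ j else flag w x) ⌋
    ≡⟨ cong (λ c → ⌊ b ≟ c ⌋) (sym (flag-update w i e x)) ⟩
      ⌊ b ≟ flag (w [ i ]≔ e) x ⌋
    ∎
    where
    j = inject₁ i
    ℓ = isLetter e
    ρ = extend j (lookup (x ∷ b ∷ []))
  update-correct w i e rQ (_ ∷ _ ∷ _ ∷ _ ∷ _ ∷ []) = refl
  update-correct w i e rS (_ ∷ _ ∷ _ ∷ _ ∷ _ ∷ _ ∷ _ ∷ []) = refl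

  reach-intended : ∀ {n s} → Reach (program {k}) n s → ∀ r js → proj₂ s r js ≡ intended (proj₁ s) r js
  reach-intended {n} start r js = init-correct n r js
  reach-intended (next op i reach _) r js =
    trans (eval-cong (reach-intended reach) (updateF (isLetter (newEntry op)) r) _)
          (update-correct _ i (newEntry op) r js)

proposition4p1 : (k : ℕ) → MaintainableInDynCQ {k} 4 RlenBar
proposition4p1 k =
  program , (λ op → updateF-isCQ (isLetter (newEntry op))) , rR , refl , λ n s reach → reach-intended reach rR
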